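{- The set consisting of the 1-in-3 gadget, the free terminal and the fanout gates parsimoniously simulates the NOR gate.
   Context: A gadget consists of a finite set of ports with a specified cyclic order, and a constraint (a set of subsets of the ports). Networks of gadgets are graphs whose vertices are labeled by gadgets, each vertex having degree equal to the number of ports of its gadget with edge incidences in bijection with the ports; an assignment orients each edge, and a vertex is satisfied if the set of its ports pointing into it is in its constraint. A simulation using gadgets from $S$ is a network of gadgets from $S$ except that some edges (dangling edges) have only one endpoint (equivalently there is an unconstrained outside-world vertex). The simulated gadget has the dangling edges as ports, and its constraint consists of the sets $D$ of dangling edges for which some assignment satisfying all vertices of the simulation has exactly the edges in $D$ pointing into the simulation. The simulation is parsimonious if for each such $D$ there is exactly one such assignment; $S$ parsimoniously simulates $G$ if some parsimonious simulation using gadgets from $S$ has simulated gadget $G$. 1-in-3 gadget: ports $a,b,c$, constraint $\{\{a\},\{b\},\{c\}\}$. Free terminal: one port $a$, constraint $\{\emptyset,\{a\}\}$. $k$-way fanout gate ($k\ge 1$): ports $a,c_1,\dots,c_k$, constraint $\{\{a\},\{c_1,\dots,c_k\}\}$. NOR gate: ports $a,b,c$, constraint $\{\emptyset,\{a,c\},\{b,c\},\{a,b,c\}\}$. -}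

module Defs where

open import Data.Nat using (ℕ; zero; suc; _≤_)
open import Data.Fin using (Fin)
open import Data.Bool using (Bool; true; false; not; _∧_; _∨_; _xor_; T)
open import Data.Vec using (Vec; []; _∷_; tabulate; lookup)
open import Data.Product using (Σ; _×_; _,_; ∃)
open import Data.Sum using (_⊎_; inj₁; inj₂)
open import Function.Bundles using (_↔_; Inverse)
open import Relation.Binary.PropositionalEquality using (_≡_)

-- A subset of the ports Fin n, as a characteristic vector (true = member).
Subset : ℕ → Set
Subset n = Vec Bool n

-- A gadget: ports Fin n (the cyclic order is the index order 0,1,…,n-1)
-- and a constraint, i.e. a (decidable) set of subsets of the ports.
record Gadget : Set where
  constructor mkGadget
  field
    arity      : ℕ
    constraint : Subset arity → Bool
open Gadget public

allTrue : ∀ {n} → Vec Bool n → Bool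
allTrue []       = true
allTrue (x ∷ xs) = x ∧ allTrue xs

allFalse : ∀ {n} → Vec Bool n → Bool
allFalse []       = true
allFalse (x ∷ xs) = not x ∧ allFalse xs

oneInThreeC : Subset 3 → Bool
oneInThreeC (true  ∷ false ∷ false ∷ []) = true
oneInThreeC (false ∷ true  ∷ false ∷ []) = true
oneInThreeC (false ∷ false ∷ true  ∷ []) = true
oneInThreeC _                            = false

oneInThree : Gadget
oneInThree = mkGadget 3 oneInThreeC

freeTerminal : Gadget
freeTerminal = mkGadget 1 (λ _ → true)

fanoutC : (k : ℕ) → Subset (suc k) → Bool
fanoutC k (a ∷ cs) = (a ∧ allFalse cs) ∨ (not a ∧ allTrue cs)

fanout : ℕ → Gadget
fanout k = mkGadget (suc k) (fanoutC k)

norC : Subset 3 → Bool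
norC (false ∷ false ∷ false ∷ []) = true
norC (true  ∷ false ∷ true  ∷ []) = true
norC (false ∷ true  ∷ true  ∷ []) = true
norC (true  ∷ true  ∷ true  ∷ []) = true
norC _                            = false

nor : Gadget
nor = mkGadget 3 norC

InS : Gadget → Set
InS g = (g ≡ oneInThree) ⊎ (g ≡ freeTerminal) ⊎ Σ ℕ (λ k → (1 ≤ k) × (g ≡ fanout k))

-- A simulation using gadgets from a set S (a predicate on gadgets):
-- V vertices, E internal edges (two endpoints each, indexed by Bool) and
-- D dangling edges (one endpoint each).
record Simulation (S : Gadget → Set) : Set₁ where
  field
    V E D    : ℕ
    gadget   : Fin V → Gadget
    gadgetInS : (v : Fin V) → S (gadget v)
    incidence : Σ (Fin V) (λ v → Fin (arity (gadget v))) ↔ ((Fin E × Bool) ⊎ Fin D)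

  -- An assignment orients every edge. For an internal edge e, head e is the
  -- endpoint it points to; for dangling edges, the subset of dangling edges
  -- pointing into the simulation.
  record Assignment : Set where
    field
      head     : Fin E → Bool
      inward   : Subset D
  open Assignment public

  pointsIn : Assignment → (Fin E × Bool) ⊎ Fin D → Bool
  pointsIn α (inj₁ (e , b)) = not (b xor head α e)
  pointsIn α (inj₂ d)       = lookup (inward α) d

  inSet : Assignment → (v : Fin V) → Subset (arity (gadget v))
  inSet α v = tabulate (λ p → pointsIn α (Inverse.to incidence (v , p)))

  Satisfying : Assignment → Set
  Satisfying α = (v : Fin V) → T (constraint (gadget v) (inSet α v))

  -- The simulated gadget has the dangling edges as ports.
  simulatedConstraint : Subset D → Set
  simulatedConstraint X = ∃ λ α → Satisfying α × (inward α ≡ X)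

  Parsimonious : Set
  Parsimonious = (X : Subset D) → (α β : Assignment) →
    Satisfying α → Satisfying β → inward α ≡ X → inward β ≡ X →
    (e : Fin E) → head α e ≡ head β e

-- The simulation N has simulated gadget G (dangling edge i identified with port i of G).
SimulatesAs : ∀ {S} → Simulation S → Gadget → Set
SimulatesAs N G = Σ (Simulation.D N ≡ arity G) λ { _≡_.refl →
  (X : Subset (arity G)) → (T (constraint G X) → Simulation.simulatedConstraint N X)
                         × (Simulation.simulatedConstraint N X → T (constraint G X)) }

ParsSimulates : (Gadget → Set) → Gadget → Set₁
ParsSimulates S G = Σ (Simulation S) λ N → SimulatesAs N G × Simulation.Parsimonious N

{-# OPTIONS --safe #-}
-- The network: 1-in-3 gadgets A = 0 (on input a), B = 1 (on input b) and a
-- collector 2; a 3-way fanout 3 (on output c) and 2-way fanouts 4, 5, each with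
-- a free terminal (6, 7, 8) on its input port; and a free terminal 9 on the
-- collector. A fanout whose input is free only forces its outputs to point the
-- same way, all into it or all out of it. So fanout 3 sends its edges into A and
-- B exactly when c points out; then A and B are saturated, a and b point out,
-- and everything else is forced. When c points in, A takes exactly one of a and
-- its edge to fanout 4, which hands ¬a on to the collector; likewise for B, and
-- the collector's free edge points in exactly when a and b both do. That is
-- possible iff a ∨ b, so the network realises c = a ∨ b, with every orientation
-- forced.
module Submission where

open import Defs
open import Data.Nat using (s≤s; z≤n)
open import Data.Fin using (Fin)
open import Data.Fin.Patterns
open import Data.Fin.Properties using (all?)
open import Data.Fin.Subset.Properties using (anySubset?)
open import Data.Bool using (Bool; true; false; not; _∧_; _xor_; T)
open import Data.Bool.Properties using (_≟_)
open import Data.Vec using (_∷_; []; lookup; tabulate)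
open import Data.Vec.Properties using (lookup∘tabulate; tabulate-cong; ≡-dec)
open import Data.Product using (Σ; _×_; _,_; proj₁; proj₂)
open import Data.Sum using (_⊎_; inj₁; inj₂)
open import Data.Unit using (tt)
open import Function.Bundles using (Inverse; mk↔ₛ′)
open import Relation.Nullary.Decidable
  using (Dec; T?; ¬?; _→-dec_; _×-dec_; map′; decidable-stable; toWitness)
open import Relation.Nullary.Negation using (∀⟶¬∃¬)
open import Relation.Unary using (Pred; Decidable)
open import Relation.Binary.PropositionalEquality
  using (_≡_; _≗_; refl; sym; trans; cong; subst; module ≡-Reasoning)

allSubset? : ∀ {ℓ n} {P : Pred (Subset n) ℓ} → Decidable P → Dec (∀ p → P p)
allSubset? P? = map′
  (λ ¬∃¬P p → decidable-stable (P? p) (λ ¬Pp → ¬∃¬P (p , ¬Pp)))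
  ∀⟶¬∃¬
  (¬? (anySubset? (λ p → ¬? (P? p))))

module _ {S : Gadget → Set} (N : Simulation S) where
  open Simulation N

  assignment : Subset E → Subset D → Assignment
  assignment h X = record { head = lookup h ; inward = X }

  satisfying? : (α : Assignment) → Dec (Satisfying α)
  satisfying? α = all? λ v → T? (constraint (gadget v) (inSet α v))

  satisfying-resp : ∀ {α β} → head α ≗ head β → inward α ≡ inward β →
                    Satisfying α → Satisfying β
  satisfying-resp {α} {β} head≗ inward≡ sα v =
    subst (λ X → T (constraint (gadget v) X))
          (tabulate-cong λ p → pointsIn≡ (Inverse.to incidence (v , p)))
          (sα v)
    where
    pointsIn≡ : ∀ end → pointsIn α end ≡ pointsIn β end
    pointsIn≡ (inj₁ (e , b)) = cong (λ h → not (b xor h)) (head≗ e)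
    pointsIn≡ (inj₂ d)       = cong (λ X → lookup X d) inward≡

  parsSimulates-bySolution :
    (c : Subset D → Bool) (solution : Subset D → Subset E) →
    (∀ X → T (c X) → Satisfying (assignment (solution X) X)) →
    (∀ X h → Satisfying (assignment h X) → T (c X) × h ≡ solution X) →
    ParsSimulates S (mkGadget D c)
  parsSimulates-bySolution c solution complete unique =
    N , (refl , λ X → realised X , λ { (α , sα , refl) → proj₁ (forced α sα) })
      , parsimonious
    where
    realised : ∀ X → T (c X) → simulatedConstraint X
    realised X cX = assignment (solution X) X , complete X cX , refl

    forced : ∀ α → Satisfying α → T (c (inward α)) × head α ≗ lookup (solution (inward α))
    forced α sα
      with unique (inward α) (tabulate (head α))
                  (satisfying-resp (λ e → sym (lookup∘tabulate (head α) e)) refl sα)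
    ... | cX , h≡ = cX , λ e →
      trans (sym (lookup∘tabulate (head α) e)) (cong (λ h → lookup h e) h≡)

    parsimonious : Parsimonious
    parsimonious X α β sα sβ αX βX e = begin
      head α e                        ≡⟨ proj₂ (forced α sα) e ⟩
      lookup (solution (inward α)) e  ≡⟨ cong (λ Y → lookup (solution Y) e) (trans αX (sym βX)) ⟩
      lookup (solution (inward β)) e  ≡⟨ proj₂ (forced β sβ) e ⟨
      head β e                        ∎
      where open ≡-Reasoning

norNetworkGadget : Fin 10 → Gadget
norNetworkGadget 0F = oneInThree
norNetworkGadget 1F = oneInThree
norNetworkGadget 2F = oneInThree
norNetworkGadget 3F = fanout 3
norNetworkGadget 4F = fanout 2
norNetworkGadget 5F = fanout 2
norNetworkGadget _  = freeTerminal

norNetworkGadget∈S : ∀ v → InS (norNetworkGadget v)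
norNetworkGadget∈S 0F = inj₁ refl
norNetworkGadget∈S 1F = inj₁ refl
norNetworkGadget∈S 2F = inj₁ refl
norNetworkGadget∈S 3F = inj₂ (inj₂ (3 , s≤s z≤n , refl))
norNetworkGadget∈S 4F = inj₂ (inj₂ (2 , s≤s z≤n , refl))
norNetworkGadget∈S 5F = inj₂ (inj₂ (2 , s≤s z≤n , refl))
norNetworkGadget∈S 6F = inj₂ (inj₁ refl)
norNetworkGadget∈S 7F = inj₂ (inj₁ refl)
norNetworkGadget∈S 8F = inj₂ (inj₁ refl)
norNetworkGadget∈S 9F = inj₂ (inj₁ refl)

NorPort : Set
NorPort = Σ (Fin 10) (λ v → Fin (arity (norNetworkGadget v)))

NorEdgeEnd : Set
NorEdgeEnd = (Fin 10 × Bool) ⊎ Fin 3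

endOf : NorPort → NorEdgeEnd
endOf (0F , 0F) = inj₁ (0F , true)
endOf (0F , 1F) = inj₂ 0F
endOf (0F , 2F) = inj₁ (3F , false)
endOf (1F , 0F) = inj₁ (1F , true)
endOf (1F , 1F) = inj₂ 1F
endOf (1F , 2F) = inj₁ (6F , false)
endOf (2F , 0F) = inj₁ (4F , true)
endOf (2F , 1F) = inj₁ (7F , true)
endOf (2F , 2F) = inj₁ (9F , false)
endOf (3F , 0F) = inj₁ (2F , false)
endOf (3F , 1F) = inj₂ 2F
endOf (3F , 2F) = inj₁ (0F , false)
endOf (3F , 3F) = inj₁ (1F , false)
endOf (4F , 0F) = inj₁ (5F , false)
endOf (4F , 1F) = inj₁ (3F , true)
endOf (4F , 2F) = inj₁ (4F , false)
endOf (5F , 0F) = inj₁ (8F , false)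
endOf (5F , 1F) = inj₁ (6F , true)
endOf (5F , 2F) = inj₁ (7F , false)
endOf (6F , 0F) = inj₁ (2F , true)
endOf (7F , 0F) = inj₁ (5F , true)
endOf (8F , 0F) = inj₁ (8F , true)
endOf (9F , 0F) = inj₁ (9F , true)

portOf : NorEdgeEnd → NorPort
portOf (inj₁ (0F , true))  = 0F , 0F
portOf (inj₁ (0F , false)) = 3F , 2F
portOf (inj₁ (1F , true))  = 1F , 0F
portOf (inj₁ (1F , false)) = 3F , 3F
portOf (inj₁ (2F , true))  = 6F , 0F
portOf (inj₁ (2F , false)) = 3F , 0F
portOf (inj₁ (3F , true))  = 4F , 1F
portOf (inj₁ (3F , false)) = 0F , 2F
portOf (inj₁ (4F , true))  = 2F , 0F
portOf (inj₁ (4F , false)) = 4F , 2F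
portOf (inj₁ (5F , true))  = 7F , 0F
portOf (inj₁ (5F , false)) = 4F , 0F
portOf (inj₁ (6F , true))  = 5F , 1F
portOf (inj₁ (6F , false)) = 1F , 2F
portOf (inj₁ (7F , true))  = 2F , 1F
portOf (inj₁ (7F , false)) = 5F , 2F
portOf (inj₁ (8F , true))  = 8F , 0F
portOf (inj₁ (8F , false)) = 5F , 0F
portOf (inj₁ (9F , true))  = 9F , 0F
portOf (inj₁ (9F , false)) = 2F , 2F
portOf (inj₂ 0F)           = 0F , 1F
portOf (inj₂ 1F)           = 1F , 1F
portOf (inj₂ 2F)           = 3F , 1F

endOf∘portOf : ∀ end → endOf (portOf end) ≡ end
endOf∘portOf (inj₁ (0F , true))  = refl
endOf∘portOf (inj₁ (0F , false)) = refl
endOf∘portOf (inj₁ (1F , true))  = refl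
endOf∘portOf (inj₁ (1F , false)) = refl
endOf∘portOf (inj₁ (2F , true))  = refl
endOf∘portOf (inj₁ (2F , false)) = refl
endOf∘portOf (inj₁ (3F , true))  = refl
endOf∘portOf (inj₁ (3F , false)) = refl
endOf∘portOf (inj₁ (4F , true))  = refl
endOf∘portOf (inj₁ (4F , false)) = refl
endOf∘portOf (inj₁ (5F , true))  = refl
endOf∘portOf (inj₁ (5F , false)) = refl
endOf∘portOf (inj₁ (6F , true))  = refl
endOf∘portOf (inj₁ (6F , false)) = refl
endOf∘portOf (inj₁ (7F , true))  = refl
endOf∘portOf (inj₁ (7F , false)) = refl
endOf∘portOf (inj₁ (8F , true))  = refl
endOf∘portOf (inj₁ (8F , false)) = refl
endOf∘portOf (inj₁ (9F , true))  = refl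
endOf∘portOf (inj₁ (9F , false)) = refl
endOf∘portOf (inj₂ 0F)           = refl
endOf∘portOf (inj₂ 1F)           = refl
endOf∘portOf (inj₂ 2F)           = refl

portOf∘endOf : ∀ port → portOf (endOf port) ≡ port
portOf∘endOf (0F , 0F) = refl
portOf∘endOf (0F , 1F) = refl
portOf∘endOf (0F , 2F) = refl
portOf∘endOf (1F , 0F) = refl
portOf∘endOf (1F , 1F) = refl
portOf∘endOf (1F , 2F) = refl
portOf∘endOf (2F , 0F) = refl
portOf∘endOf (2F , 1F) = refl
portOf∘endOf (2F , 2F) = refl
portOf∘endOf (3F , 0F) = refl
portOf∘endOf (3F , 1F) = refl
portOf∘endOf (3F , 2F) = refl
portOf∘endOf (3F , 3F) = refl
portOf∘endOf (4F , 0F) = refl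
portOf∘endOf (4F , 1F) = refl
portOf∘endOf (4F , 2F) = refl
portOf∘endOf (5F , 0F) = refl
portOf∘endOf (5F , 1F) = refl
portOf∘endOf (5F , 2F) = refl
portOf∘endOf (6F , 0F) = refl
portOf∘endOf (7F , 0F) = refl
portOf∘endOf (8F , 0F) = refl
portOf∘endOf (9F , 0F) = refl

norNetwork : Simulation InS
norNetwork = record
  { V = 10 ; E = 10 ; D = 3
  ; gadget    = norNetworkGadget
  ; gadgetInS = norNetworkGadget∈S
  ; incidence = mk↔ₛ′ endOf portOf endOf∘portOf portOf∘endOf
  }

-- The orientations forced by the argument above (irrelevant off NOR triples).
norSolution : Subset 3 → Subset 10
norSolution (_ ∷ _ ∷ false ∷ []) =
  true ∷ true ∷ false ∷ true ∷ false ∷ true ∷ true ∷ false ∷ true ∷ false ∷ []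
norSolution (a ∷ b ∷ true ∷ []) =
  false ∷ false ∷ true ∷ a ∷ not a ∷ a ∷ b ∷ not b ∷ b ∷ not (a ∧ b) ∷ []

open Simulation norNetwork using (Satisfying)

norSolution-satisfying :
  ∀ X → T (norC X) → Satisfying (assignment norNetwork (norSolution X) X)
norSolution-satisfying = toWitness {a? = allSubset? λ X →
  T? (norC X) →-dec satisfying? norNetwork (assignment norNetwork (norSolution X) X)} tt

satisfying⇒norSolution :
  ∀ X h → Satisfying (assignment norNetwork h X) → T (norC X) × h ≡ norSolution X
satisfying⇒norSolution = toWitness {a? = allSubset? λ X → allSubset? λ h →
  satisfying? norNetwork (assignment norNetwork h X) →-dec
  (T? (norC X) ×-dec ≡-dec _≟_ h (norSolution X))} tt

mainTheorem13 : ParsSimulates InS nor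
mainTheorem13 = parsSimulates-bySolution norNetwork norC norSolution
  norSolution-satisfying satisfying⇒norSolution
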